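{- Let $n,t,k$ be integers with $n\geq 2t\geq 4$ and $k\geq 2$. Let $\beta_k(t)=k-(k-1)k^{ -t-1}$. Then $A_k(n,0^t)\leq \beta_k(t)^n$.
   Context: $A_k(m,v)$ is the number of length-$m$ words over $\Sigma_k=\{0,1,\ldots,k-1\}$ that do not contain $v$ as a factor; $0^t$ is the word of $t$ zeros. -}

module Defs where

open import Data.Nat as ℕ using (ℕ; zero; suc; NonZero)
open import Data.Nat.Properties using (_≟_; m^n≢0)
open import Data.Integer using (+_)
open import Data.Rational as ℚ using (ℚ; 1ℚ; _/_)
open import Data.List using (List; []; _∷_; [_]; map; concatMap; upTo; filter; length)
open import Data.List.Relation.Binary.Infix.Heterogeneous using (Infix)
open import Data.List.Relation.Binary.Infix.Heterogeneous.Properties using (infix?)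
open import Relation.Binary.PropositionalEquality using (_≡_)
open import Relation.Nullary using (¬_; ¬?)

-- Words over Σ_k = {0,…,k-1}, letters represented by natural numbers < k.
-- allWords k m lists every word of length m over Σ_k exactly once.
allWords : ℕ → ℕ → List (List ℕ)
allWords k zero = [ [] ]
allWords k (suc m) = concatMap (λ a → map (a ∷_) (allWords k m)) (upTo k)

IsFactor : List ℕ → List ℕ → Set
IsFactor v w = Infix _≡_ v w

A : ℕ → ℕ → List ℕ → ℕ
A k m v = length (filter (λ w → ¬? (infix? _≟_ v w)) (allWords k m))

_^ℚ_ : ℚ → ℕ → ℚ
q ^ℚ zero = 1ℚ
q ^ℚ suc n = q ℚ.* (q ^ℚ n)

-- β_k(t) = k - (k-1) k^{-t-1}  (as a rational; k = 0 is irrelevant and mapped to 0)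
β : ℕ → ℕ → ℚ
β zero t = ℚ.0ℚ
β (suc j) t = ((+ suc j) / 1) ℚ.- ((+ j) / (suc j ℕ.^ suc t))
  where instance _ = m^n≢0 (suc j) (suc t)

-- Write k = c + 1 and a(m) = A_k(m, 0^t). Sorting words by their leading run of zeros gives the
-- recurrence a(t+m+1) + c·a(m) = k·a(t+m) and, for i ≤ t, the exact values
-- k·a(t+i) = k^(t+i+1) − (k + i·c)·k^i. With K = k^(t+1) we have β_k(t) = B/K where B = kK − c.
-- For m ≥ t the recurrence together with a(t+m) ≤ k^t·a(m) ≤ K·a(m) gives a(t+m+1)·K ≤ B·a(t+m),
-- so it suffices to check a(2t)·K^(2t) ≤ B^(2t); this follows from the exact value of a(2t) and
-- Bernoulli's inequality (kK)^(2t) ≤ B^(2t) + 2t·c·(kK)^(2t−1).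
module Submission where

open import Defs
open import Data.Bool using (true; false)
open import Data.Empty using (⊥-elim)
open import Data.List
  using (List; []; _∷_; _++_; map; concatMap; applyUpTo; filter; length; replicate)
open import Data.List.Properties
  using (filter-all; filter-none; filter-++; filter-≐; length-++; length-replicate; ++-identityʳ)
open import Data.List.Relation.Unary.All as All using (_∷_; [])
open import Data.List.Relation.Binary.Infix.Heterogeneous using (Infix; here; there; _++ⁱ_; _ⁱ++_)
open import Data.List.Relation.Binary.Infix.Heterogeneous.Properties using (infix?; length-mono; replicate⁺)
open import Data.List.Relation.Binary.Prefix.Heterogeneous using (Prefix; _∷_)
open import Data.Nat
  using (ℕ; zero; suc; pred; NonZero; _+_; _*_; _^_; _≤_; _<_; _≤′_; ≤′-reflexive; ≤′-step; s≤s; z≤n; z<s)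
open import Data.Nat.Properties
  using ( _≟_; +-assoc; +-comm; +-suc; +-identityʳ; +-monoʳ-≤; +-monoˡ-≤; +-cancelˡ-≤; +-cancelʳ-≤
        ; *-assoc; *-identityˡ; *-identityʳ; *-distribʳ-+; *-monoʳ-≤; *-monoˡ-≤; *-cancelˡ-≡; *-cancelˡ-≤
        ; ^-distribˡ-+-*; m^n≢0; suc-pred; m≤m+n; m≤n+m; m<m+n; m≤n*m; n≤1+n; <⇒≱; m≤n⇒∃[o]m+o≡n
        ; ≤-refl; ≤-reflexive; ≤-trans; ≤⇒≤′; ≤′⇒≤; module ≤-Reasoning)
open import Data.Nat.Tactic.RingSolver using (solve-∀)
open import Data.Integer as ℤ using (+_)
import Data.Integer.Properties as ℤ
open import Data.Integer.Tactic.RingSolver renaming (solve-∀ to ℤ-solve-∀)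
open import Data.Rational as ℚ using (_/_; toℚᵘ)
open import Data.Rational.Properties using (toℚᵘ-fromℚᵘ; toℚᵘ-homo-+; toℚᵘ-homo-*; toℚᵘ-homo‿-; toℚᵘ-cancel-≤)
open import Data.Rational.Unnormalised as ℚᵘ using (mkℚᵘ; *≡*; *≤*) renaming (_≃_ to _≃ᵘ_; _≤_ to _≤ᵘ_)
import Data.Rational.Unnormalised.Properties as ℚᵘ
open import Data.Product using (_,_)
open import Function using (_∘_)
open import Level using (0ℓ)
open import Relation.Binary.PropositionalEquality using (_≡_; refl; sym; trans; cong; cong₂; subst; subst₂; module ≡-Reasoning)
open import Relation.Nullary using (¬_; ¬?; does)
open import Relation.Unary using (Pred; Decidable; _≐_)

module _ {P : Pred (List ℕ) 0ℓ} (P? : Decidable P) where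

  length-filter-++ : ∀ xs ys →
    length (filter P? (xs ++ ys)) ≡ length (filter P? xs) + length (filter P? ys)
  length-filter-++ xs ys = trans (cong length (filter-++ P? xs ys)) (length-++ (filter P? xs))

  length-filter-map-∷ : ∀ a ws →
    length (filter P? (map (a ∷_) ws)) ≡ length (filter (P? ∘ (a ∷_)) ws)
  length-filter-map-∷ a []       = refl
  length-filter-map-∷ a (w ∷ ws) with does (P? (a ∷ w))
  ... | true  = cong suc (length-filter-map-∷ a ws)
  ... | false = length-filter-map-∷ a ws

  module _ {Q : Pred (List ℕ) 0ℓ} (Q? : Decidable Q) where

    length-filter-cons : ∀ a ws → (P ∘ (a ∷_)) ≐ Q →
      length (filter P? (map (a ∷_) ws)) ≡ length (filter Q? ws)
    length-filter-cons a ws P≐Q =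
      trans (length-filter-map-∷ a ws) (cong length (filter-≐ (P? ∘ (a ∷_)) Q? P≐Q ws))

    length-filter-conses : ∀ (f : ℕ → ℕ) n ws → (∀ i → (P ∘ (f i ∷_)) ≐ Q) →
      length (filter P? (concatMap (λ a → map (a ∷_) ws) (applyUpTo f n)))
        ≡ n * length (filter Q? ws)
    length-filter-conses f zero    ws P≐Q = refl
    length-filter-conses f (suc n) ws P≐Q =
      trans (length-filter-++ (map (f 0 ∷_) ws) _)
            (cong₂ _+_ (length-filter-cons (f 0) ws (P≐Q 0))
                       (length-filter-conses (f ∘ suc) n ws (P≐Q ∘ suc)))

  length-filter-allWords-suc : ∀ {Q R : Pred (List ℕ) 0ℓ} (Q? : Decidable Q) (R? : Decidable R) c m →
    (P ∘ (0 ∷_)) ≐ Q → (∀ a → (P ∘ (suc a ∷_)) ≐ R) →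
    length (filter P? (allWords (suc c) (suc m)))
      ≡ length (filter Q? (allWords (suc c) m)) + c * length (filter R? (allWords (suc c) m))
  length-filter-allWords-suc Q? R? c m P0≐Q Psuc≐R =
    trans (length-filter-++ (map (0 ∷_) (allWords (suc c) m)) _)
          (cong₂ _+_ (length-filter-cons Q? 0 (allWords (suc c) m) P0≐Q)
                     (length-filter-conses R? suc c (allWords (suc c) m) Psuc≐R))

zeros : ℕ → List ℕ
zeros n = replicate n 0

zeros-++-0∷ : ∀ j (w : List ℕ) → zeros j ++ 0 ∷ w ≡ zeros (suc j) ++ w
zeros-++-0∷ zero    w = refl
zeros-++-0∷ (suc j) w = cong (0 ∷_) (zeros-++-0∷ j w)

zeros-not-prefix : ∀ {j n} a w → j < n → ¬ Prefix _≡_ (zeros n) (zeros j ++ suc a ∷ w)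
zeros-not-prefix {zero}  {suc n} a w _         (() ∷ _)
zeros-not-prefix {suc j} {suc n} a w (s≤s j<n) (_ ∷ p) = zeros-not-prefix a w j<n p

zeros-infix-skip : ∀ {j n} a w → j < n →
  Infix _≡_ (zeros n) (zeros j ++ suc a ∷ w) → Infix _≡_ (zeros n) w
zeros-infix-skip {zero}  a w j<n (here p)  = ⊥-elim (zeros-not-prefix a w j<n p)
zeros-infix-skip {zero}  a w j<n (there p) = p
zeros-infix-skip {suc j} a w j<n (here p)  = ⊥-elim (zeros-not-prefix a w j<n p)
zeros-infix-skip {suc j} a w j<n (there p) = zeros-infix-skip a w (≤-trans (n≤1+n _) j<n) p

module Avoiding (t : ℕ) where

  Avoids : ℕ → Pred (List ℕ) 0ℓ
  Avoids j w = ¬ Infix _≡_ (zeros t) (zeros j ++ w)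

  avoids? : ∀ j → Decidable (Avoids j)
  avoids? j w = ¬? (infix? _≟_ (zeros t) (zeros j ++ w))

  avoids-0∷ : ∀ j → (Avoids j ∘ (0 ∷_)) ≐ Avoids (suc j)
  avoids-0∷ j = (λ {w} ¬inf inf → ¬inf (subst (Infix _≡_ (zeros t)) (sym (zeros-++-0∷ j w)) inf))
              , (λ {w} ¬inf inf → ¬inf (subst (Infix _≡_ (zeros t)) (zeros-++-0∷ j w) inf))

  avoids-suc∷ : ∀ {j} a → j < t → (Avoids j ∘ (suc a ∷_)) ≐ Avoids 0
  avoids-suc∷ {j} a j<t = (λ {w} ¬inf inf → ¬inf (zeros j ++ⁱ there inf))
                        , (λ {w} ¬inf inf → ¬inf (zeros-infix-skip a w j<t inf))

  ¬avoids : ∀ {j} → t ≤ j → ∀ w → ¬ Avoids j w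
  ¬avoids t≤j w ¬inf = ¬inf (replicate⁺ t≤j refl ⁱ++ w)

  avoids-[] : ∀ {j} → j < t → Avoids j []
  avoids-[] {j} j<t inf = <⇒≱ j<t (subst₂ _≤_ (length-replicate t) length-zeros-++-[] (length-mono inf))
    where
    length-zeros-++-[] : length (zeros j ++ []) ≡ j
    length-zeros-++-[] = trans (cong length (++-identityʳ (zeros j))) (length-replicate j)

-- N m r counts the words of length m over Σ_{c+1} that avoid 0^t and begin with fewer than r zeros.
module Counting (c t : ℕ) where

  open Avoiding t

  N : ℕ → ℕ → ℕ
  N m       zero    = 0
  N zero    (suc r) = 1
  N (suc m) (suc r) = c * N m t + N m r

  private
    j<t : ∀ {j r} → j + suc r ≡ t → j < t
    j<t {j} j+r≡t = subst (j <_) j+r≡t (m<m+n j z<s)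

  count-avoiding : ∀ j r m → j + r ≡ t → length (filter (avoids? j) (allWords (suc c) m)) ≡ N m r
  count-avoiding j zero m j+0≡t =
    cong length (filter-none (avoids? j) (All.universal (¬avoids t≤j) (allWords (suc c) m)))
    where
    t≤j : t ≤ j
    t≤j = ≤-reflexive (trans (sym j+0≡t) (+-identityʳ j))
  count-avoiding j (suc r) zero j+r≡t =
    cong length (filter-all (avoids? j) (avoids-[] (j<t j+r≡t) ∷ []))
  count-avoiding j (suc r) (suc m) j+r≡t = begin
    length (filter (avoids? j) (allWords (suc c) (suc m)))
      ≡⟨ length-filter-allWords-suc (avoids? j) (avoids? (suc j)) (avoids? 0) c m
           (avoids-0∷ j) (λ a → avoids-suc∷ a (j<t j+r≡t)) ⟩
    length (filter (avoids? (suc j)) (allWords (suc c) m)) + c * length (filter (avoids? 0) (allWords (suc c) m))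
      ≡⟨ cong₂ (λ x y → x + c * y) (count-avoiding (suc j) r m (trans (sym (+-suc j r)) j+r≡t))
                                  (count-avoiding 0 t m refl) ⟩
    N m r + c * N m t
      ≡⟨ +-comm (N m r) _ ⟩
    N (suc m) (suc r) ∎
    where open ≡-Reasoning


module Values (c s : ℕ) where

  private
    t k : ℕ
    t = suc s
    k = suc c

  open Counting c t

  N-shift : ∀ r m → N (suc (r + m)) (suc r) ≡ N (suc (r + m)) r + c * N m t
  N-shift zero    m = +-identityʳ _
  N-shift (suc r) m = begin
    c * N (suc r + m) t + N (suc (r + m)) (suc r)   ≡⟨ cong (λ x → c * N (suc r + m) t + x) (N-shift r m) ⟩
    c * N (suc r + m) t + (N (suc (r + m)) r + c * N m t) ≡⟨ +-assoc (c * N (suc r + m) t) _ _ ⟨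
    N (suc (suc r + m)) (suc r) + c * N m t         ∎
    where open ≡-Reasoning

  recurrence : ∀ m → N (suc (t + m)) t + c * N m t ≡ k * N (t + m) t
  recurrence m = begin
    c * N (t + m) t + N (t + m) s + c * N m t   ≡⟨ +-assoc (c * N (t + m) t) _ _ ⟩
    c * N (t + m) t + (N (t + m) s + c * N m t) ≡⟨ cong (λ x → c * N (t + m) t + x) (N-shift s m) ⟨
    c * N (t + m) t + N (t + m) t               ≡⟨ +-comm (c * N (t + m) t) _ ⟩
    k * N (t + m) t                             ∎
    where open ≡-Reasoning

  N-short : ∀ {m r} → m < t → m < r → N m r ≡ k ^ m
  N-short {zero}  {suc r} _   _         = refl
  N-short {suc m} {suc r} m<t (s≤s m<r) =
    trans (cong₂ (λ x y → c * x + y) (N-short m<t′ m<t′) (N-short m<t′ m<r)) (+-comm (c * k ^ m) _)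
    where
    m<t′ : m < t
    m<t′ = ≤-trans (n≤1+n _) m<t

  N-diagonal : ∀ {m} → m ≤ t → N m m + 1 ≡ k ^ m
  N-diagonal {zero}  _   = refl
  N-diagonal {suc m} m<t = begin
    c * N m t + N m m + 1   ≡⟨ +-assoc (c * N m t) _ 1 ⟩
    c * N m t + (N m m + 1) ≡⟨ cong₂ (λ x y → c * x + y) (N-short m<t m<t) (N-diagonal (≤-trans (n≤1+n m) m<t)) ⟩
    c * k ^ m + k ^ m       ≡⟨ +-comm (c * k ^ m) _ ⟩
    k ^ suc m               ∎
    where open ≡-Reasoning

  N-explicit : ∀ {i} → i ≤ t → N (t + i) t * k + (k + i * c) * k ^ i ≡ k ^ (t + i) * k
  N-explicit {zero} _ = begin
    N (t + 0) t * k + (k + 0 * c) * 1 ≡⟨ cong (λ n → N n t * k + (k + 0 * c) * 1) (+-identityʳ t) ⟩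
    N t t * k + (k + 0 * c) * 1       ≡⟨ identity (N t t) k c ⟩
    (N t t + 1) * k                   ≡⟨ cong (_* k) (N-diagonal ≤-refl) ⟩
    k ^ t * k                         ≡⟨ cong (λ n → k ^ n * k) (+-identityʳ t) ⟨
    k ^ (t + 0) * k                   ∎
    where
    open ≡-Reasoning
    identity : ∀ x k c → x * k + (k + 0 * c) * 1 ≡ (x + 1) * k
    identity = solve-∀
  N-explicit {suc i} i<t = begin
    N (t + suc i) t * k + (k + suc i * c) * k ^ suc i
      ≡⟨ cong (λ n → N n t * k + (k + suc i * c) * k ^ suc i) (+-suc t i) ⟩
    N (suc (t + i)) t * k + (k + suc i * c) * (k * k ^ i)
      ≡⟨ split (N (suc (t + i)) t) (k ^ i) k c i ⟩
    (N (suc (t + i)) t + c * k ^ i) * k + k * ((k + i * c) * k ^ i)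
      ≡⟨ cong (λ x → (N (suc (t + i)) t + c * x) * k + k * ((k + i * c) * k ^ i)) (N-short i<t i<t) ⟨
    (N (suc (t + i)) t + c * N i t) * k + k * ((k + i * c) * k ^ i)
      ≡⟨ cong (λ x → x * k + k * ((k + i * c) * k ^ i)) (recurrence i) ⟩
    k * N (t + i) t * k + k * ((k + i * c) * k ^ i)
      ≡⟨ merge (N (t + i) t) (k ^ i) k c i ⟩
    k * (N (t + i) t * k + (k + i * c) * k ^ i)
      ≡⟨ cong (k *_) (N-explicit (≤-trans (n≤1+n i) i<t)) ⟩
    k * (k ^ (t + i) * k)
      ≡⟨ *-assoc k (k ^ (t + i)) k ⟨
    k ^ suc (t + i) * k
      ≡⟨ cong (λ n → k ^ n * k) (+-suc t i) ⟨
    k ^ (t + suc i) * k ∎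
    where
    open ≡-Reasoning
    split : ∀ x p k c i → x * k + (k + suc i * c) * (k * p) ≡ (x + c * p) * k + k * ((k + i * c) * p)
    split = solve-∀
    merge : ∀ x p k c i → k * x * k + k * ((k + i * c) * p) ≡ k * (x * k + (k + i * c) * p)
    merge = solve-∀

module Recurrent (c t : ℕ) (a : ℕ → ℕ)
                 (recurrence : ∀ m → a (suc (t + m)) + c * a m ≡ suc c * a (t + m)) where

  private
    k : ℕ
    k = suc c

  growth-suc : ∀ {j} → t ≤ j → a (suc j) ≤ k * a j
  growth-suc t≤j with m≤n⇒∃[o]m+o≡n t≤j
  ... | m , refl = ≤-trans (m≤m+n _ (c * a m)) (≤-reflexive (recurrence m))

  growth : ∀ i {m} → t ≤ m → a (i + m) ≤ k ^ i * a m
  growth zero    t≤m = ≤-reflexive (sym (*-identityˡ _))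
  growth (suc i) {m} t≤m = begin
    a (suc (i + m))   ≤⟨ growth-suc (≤-trans t≤m (m≤n+m m i)) ⟩
    k * a (i + m)     ≤⟨ *-monoʳ-≤ k (growth i t≤m) ⟩
    k * (k ^ i * a m) ≡⟨ *-assoc k (k ^ i) (a m) ⟨
    k ^ suc i * a m   ∎
    where open ≤-Reasoning

  ratio-bound : ∀ {K B} → k ^ t ≤ K → B + c ≡ k * K → ∀ {n} → t + t ≤ n → a (suc n) * K ≤ B * a n
  ratio-bound {K} {B} k^t≤K B+c≡kK 2t≤n with m≤n⇒∃[o]m+o≡n (≤-trans (m≤m+n t t) 2t≤n)
  ... | m , refl = +-cancelʳ-≤ (c * a (t + m)) _ _ (begin
    a (suc (t + m)) * K + c * a (t + m) ≤⟨ +-monoʳ-≤ (a (suc (t + m)) * K) (*-monoʳ-≤ c a[t+m]≤Ka[m]) ⟩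
    a (suc (t + m)) * K + c * (K * a m) ≡⟨ factor (a (suc (t + m))) (a m) c K ⟩
    (a (suc (t + m)) + c * a m) * K     ≡⟨ cong (_* K) (recurrence m) ⟩
    k * a (t + m) * K                   ≡⟨ swap k (a (t + m)) K ⟩
    k * K * a (t + m)                   ≡⟨ cong (_* a (t + m)) B+c≡kK ⟨
    (B + c) * a (t + m)                 ≡⟨ *-distribʳ-+ (a (t + m)) B c ⟩
    B * a (t + m) + c * a (t + m)       ∎)
    where
    open ≤-Reasoning
    a[t+m]≤Ka[m] : a (t + m) ≤ K * a m
    a[t+m]≤Ka[m] = ≤-trans (growth t (+-cancelˡ-≤ t t m 2t≤n)) (*-monoˡ-≤ (a m) k^t≤K)
    factor : ∀ x y c K → x * K + c * (K * y) ≡ (x + c * y) * K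
    factor = solve-∀
    swap : ∀ k x K → k * x * K ≡ k * K * x
    swap = solve-∀

geometric-bound : ∀ (a : ℕ → ℕ) {K B n₀} → (∀ {n} → n₀ ≤ n → a (suc n) * K ≤ B * a n) →
  a n₀ * K ^ n₀ ≤ B ^ n₀ → ∀ {n} → n₀ ≤ n → a n * K ^ n ≤ B ^ n
geometric-bound a {K} {B} {n₀} ratio base n₀≤n = go (≤⇒≤′ n₀≤n)
  where
  open ≤-Reasoning
  go : ∀ {n} → n₀ ≤′ n → a n * K ^ n ≤ B ^ n
  go (≤′-reflexive refl) = base
  go (≤′-step {n} n₀≤′n) = begin
    a (suc n) * (K * K ^ n) ≡⟨ *-assoc (a (suc n)) K _ ⟨
    a (suc n) * K * K ^ n   ≤⟨ *-monoˡ-≤ (K ^ n) (ratio (≤′⇒≤ n₀≤′n)) ⟩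
    B * a n * K ^ n         ≡⟨ *-assoc B _ _ ⟩
    B * (a n * K ^ n)       ≤⟨ *-monoʳ-≤ B (go n₀≤′n) ⟩
    B * B ^ n               ∎

bernoulli : ∀ b c n → (b + c) ^ suc n ≤ b ^ suc n + suc n * c * (b + c) ^ n
bernoulli b c zero    = ≤-reflexive (base b c)
  where
  base : ∀ b c → (b + c) * 1 ≡ b * 1 + 1 * c * 1
  base = solve-∀
bernoulli b c (suc n) = begin
  (b + c) * (b + c) ^ suc n                                      ≡⟨ *-distribʳ-+ _ b c ⟩
  b * (b + c) ^ suc n + c * (b + c) ^ suc n                      ≤⟨ +-monoˡ-≤ _ (*-monoʳ-≤ b (bernoulli b c n)) ⟩
  b * (b ^ suc n + suc n * c * (b + c) ^ n) + c * (b + c) ^ suc n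
    ≡⟨ distribute b (b ^ suc n) n c ((b + c) ^ n) ((b + c) ^ suc n) ⟩
  b ^ suc (suc n) + suc n * c * (b * (b + c) ^ n) + c * (b + c) ^ suc n
    ≤⟨ +-monoˡ-≤ _ (+-monoʳ-≤ (b ^ suc (suc n)) (*-monoʳ-≤ (suc n * c) (*-monoˡ-≤ _ (m≤m+n b c)))) ⟩
  b ^ suc (suc n) + suc n * c * ((b + c) * (b + c) ^ n) + c * (b + c) ^ suc n
    ≡⟨ collect (b ^ suc (suc n)) n c ((b + c) ^ suc n) ⟩
  b ^ suc (suc n) + suc (suc n) * c * (b + c) ^ suc n            ∎
  where
  open ≤-Reasoning
  distribute : ∀ b p n c x y → b * (p + suc n * c * x) + c * y ≡ b * p + suc n * c * (b * x) + c * y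
  distribute = solve-∀
  collect : ∀ p n c y → p + suc n * c * y + c * y ≡ p + suc (suc n) * c * y
  collect = solve-∀

^-distribʳ-* : ∀ m n o → (n * o) ^ m ≡ n ^ m * o ^ m
^-distribʳ-* zero    n o = refl
^-distribʳ-* (suc m) n o = trans (cong ((n * o) *_) (^-distribʳ-* m n o)) (interchange n o (n ^ m) (o ^ m))
  where
  interchange : ∀ x y p q → x * y * (p * q) ≡ x * p * (y * q)
  interchange = solve-∀

toℚᵘ-/ : ∀ i n .{{_ : NonZero n}} → toℚᵘ (i / n) ≃ᵘ mkℚᵘ i (pred n)
toℚᵘ-/ i (suc n) = toℚᵘ-fromℚᵘ (mkℚᵘ i n)

mkℚᵘ-* : ∀ a b d e .{{_ : NonZero d}} .{{_ : NonZero e}} →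
  mkℚᵘ (+ a) (pred d) ℚᵘ.* mkℚᵘ (+ b) (pred e) ≃ᵘ mkℚᵘ (+ (a * b)) (pred (d * e))
mkℚᵘ-* a b (suc d) (suc e) = *≡* (cong (ℤ._* + suc (e + d * suc e)) (sym (ℤ.pos-* a b)))

mkℚᵘ-≤ : ∀ a b d .{{_ : NonZero d}} → a * d ≤ b → mkℚᵘ (+ a) 0 ≤ᵘ mkℚᵘ (+ b) (pred d)
mkℚᵘ-≤ a b (suc d) ad≤b =
  *≤* (subst₂ ℤ._≤_ (ℤ.pos-* a (suc d)) (ℤ.pos-* b 1) (ℤ.+≤+ (≤-trans ad≤b (≤-reflexive (sym (*-identityʳ b))))))

toℚᵘ-^ℚ : ∀ {q b d} .{{_ : NonZero d}} → toℚᵘ q ≃ᵘ mkℚᵘ (+ b) (pred d) →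
  ∀ n → toℚᵘ (q ^ℚ n) ≃ᵘ mkℚᵘ (+ (b ^ n)) (pred (d ^ n))
toℚᵘ-^ℚ         q≃ zero    = *≡* refl
toℚᵘ-^ℚ {q} {b} {d} q≃ (suc n) = begin
  toℚᵘ (q ℚ.* q ^ℚ n)                                   ≈⟨ toℚᵘ-homo-* q (q ^ℚ n) ⟩
  toℚᵘ q ℚᵘ.* toℚᵘ (q ^ℚ n)                             ≈⟨ ℚᵘ.*-cong q≃ (toℚᵘ-^ℚ q≃ n) ⟩
  mkℚᵘ (+ b) (pred d) ℚᵘ.* mkℚᵘ (+ (b ^ n)) (pred (d ^ n)) ≈⟨ mkℚᵘ-* b (b ^ n) d (d ^ n) ⟩
  mkℚᵘ (+ (b * b ^ n)) (pred (d * d ^ n))               ∎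
  where
  open ℚᵘ.≃-Reasoning
  instance _ = m^n≢0 d n

suc-minus-fraction : ∀ c K .{{_ : NonZero K}} →
  mkℚᵘ (+ suc c) 0 ℚᵘ.- mkℚᵘ (+ c) (pred K) ≃ᵘ mkℚᵘ (+ (K + c * pred K)) (pred K)
suc-minus-fraction c (suc K′) =
  *≡* (trans (identity (+ c) (+ K′)) (cong (λ x → (+ suc K′ ℤ.+ x) ℤ.* (+ 1 ℤ.* + suc K′)) (sym (ℤ.pos-* c K′))))
  where
  identity : ∀ (x y : ℤ.ℤ) → ((+ 1 ℤ.+ x) ℤ.* (+ 1 ℤ.+ y) ℤ.+ (ℤ.- x) ℤ.* + 1) ℤ.* (+ 1 ℤ.+ y)
                            ≡ ((+ 1 ℤ.+ y) ℤ.+ x ℤ.* y) ℤ.* (+ 1 ℤ.* (+ 1 ℤ.+ y))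
  identity = ℤ-solve-∀

module Bound (c s : ℕ) where

  k t K : ℕ
  k = suc c
  t = suc s
  K = k ^ suc t

  instance
    K≢0 : NonZero K
    K≢0 = m^n≢0 k (suc t)

  -- k − c/K = (kK − c)/K, and kK − c = K + c·(K − 1) avoids truncated subtraction.
  B : ℕ
  B = K + c * pred K

  B+c≡kK : B + c ≡ k * K
  B+c≡kK = subst (λ x → x + c * pred x + c ≡ k * x) (suc-pred K) (identity c (pred K))
    where
    identity : ∀ c K′ → suc K′ + c * K′ + c ≡ suc c * suc K′
    identity = solve-∀

  β≃B/K : toℚᵘ (β k t) ≃ᵘ mkℚᵘ (+ B) (pred K)
  β≃B/K = begin
    toℚᵘ ((+ k) / 1 ℚ.- (+ c) / K)               ≈⟨ toℚᵘ-homo-+ ((+ k) / 1) _ ⟩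
    toℚᵘ ((+ k) / 1) ℚᵘ.+ toℚᵘ (ℚ.- ((+ c) / K))
      ≈⟨ ℚᵘ.+-cong (toℚᵘ-/ (+ k) 1) (ℚᵘ.≃-trans (toℚᵘ-homo‿- ((+ c) / K)) (ℚᵘ.-‿cong (toℚᵘ-/ (+ c) K))) ⟩
    mkℚᵘ (+ k) 0 ℚᵘ.- mkℚᵘ (+ c) (pred K)        ≈⟨ suc-minus-fraction c K ⟩
    mkℚᵘ (+ B) (pred K)                          ∎
    where open ℚᵘ.≃-Reasoning

  base-bound : ∀ X → 1 ≤ c → X * k + t * c * k ^ t ≤ k ^ (t + t) * k → X * K ^ (t + t) ≤ B ^ (t + t)
  base-bound X 1≤c hyp = +-cancelʳ-≤ ((t + t) * c * W) _ _ (≤-trans key bernoulli′)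
    where
    C Q W : ℕ
    C = k * K
    Q = K ^ (t + t)
    W = C ^ (s + t)

    bernoulli′ : C ^ (t + t) ≤ B ^ (t + t) + (t + t) * c * W
    bernoulli′ = subst (λ C → C ^ (t + t) ≤ B ^ (t + t) + (t + t) * c * C ^ (s + t)) B+c≡kK (bernoulli B c (s + t))

    kkW≡k^tQ : k * k * W ≡ k ^ t * Q
    kkW≡k^tQ = *-cancelˡ-≡ _ _ (k ^ t) {{m^n≢0 k t}} (begin
      k ^ t * (k * k * W)   ≡⟨ rearrange (k ^ t) k W ⟩
      C * W                 ≡⟨ ^-distribʳ-* (t + t) k K ⟩
      k ^ (t + t) * Q       ≡⟨ cong (_* Q) (^-distribˡ-+-* k t t) ⟩
      k ^ t * k ^ t * Q     ≡⟨ *-assoc (k ^ t) _ Q ⟩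
      k ^ t * (k ^ t * Q)   ∎)
      where
      open ≡-Reasoning
      rearrange : ∀ p k w → p * (k * k * w) ≡ k * (k * p) * w
      rearrange = solve-∀

    key : X * Q + (t + t) * c * W ≤ C ^ (t + t)
    key = *-cancelˡ-≤ k (begin
      k * (X * Q + (t + t) * c * W)     ≡⟨ spread X Q t c W k ⟩
      X * k * Q + t * c * (2 * k * W)   ≤⟨ +-monoʳ-≤ (X * k * Q) (*-monoʳ-≤ (t * c) (*-monoˡ-≤ W (*-monoˡ-≤ k (s≤s 1≤c)))) ⟩
      X * k * Q + t * c * (k * k * W)   ≡⟨ cong (λ y → X * k * Q + t * c * y) kkW≡k^tQ ⟩
      X * k * Q + t * c * (k ^ t * Q)   ≡⟨ gather X Q t c k (k ^ t) ⟩
      (X * k + t * c * k ^ t) * Q       ≤⟨ *-monoˡ-≤ Q hyp ⟩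
      k ^ (t + t) * k * Q               ≡⟨ rotate k (k ^ (t + t)) Q ⟩
      k * (k ^ (t + t) * Q)             ≡⟨ cong (k *_) (^-distribʳ-* (t + t) k K) ⟨
      k * C ^ (t + t)                   ∎)
      where
      open ≤-Reasoning
      spread : ∀ X Q t c W k → k * (X * Q + (t + t) * c * W) ≡ X * k * Q + t * c * (2 * k * W)
      spread = solve-∀
      gather : ∀ X Q t c k p → X * k * Q + t * c * (p * Q) ≡ (X * k + t * c * p) * Q
      gather = solve-∀
      rotate : ∀ k p Q → p * k * Q ≡ k * (p * Q)
      rotate = solve-∀

  avoiding-bound : ∀ {n} → 1 ≤ c → 2 * t ≤ n → A k n (zeros t) * K ^ n ≤ B ^ n
  avoiding-bound {n} 1≤c 2t≤n =
    subst (λ x → x * K ^ n ≤ B ^ n) (sym (count-avoiding 0 t n refl))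
      (geometric-bound (λ m → N m t) (ratio-bound (m≤n*m (k ^ t) k) B+c≡kK)
                       (base-bound (N (t + t) t) 1≤c value-at-2t) (subst (_≤ n) (cong (λ x → t + x) (+-identityʳ t)) 2t≤n))
    where
    open Counting c t using (N; count-avoiding)
    open Values c s using (recurrence; N-explicit)
    open Recurrent c t (λ m → N m t) recurrence using (ratio-bound)

    value-at-2t : N (t + t) t * k + t * c * k ^ t ≤ k ^ (t + t) * k
    value-at-2t = ≤-trans (+-monoʳ-≤ _ (*-monoˡ-≤ (k ^ t) (m≤n+m (t * c) k))) (≤-reflexive (N-explicit ≤-refl))

-- The hypothesis 4 ≤ 2t is only needed to exclude t = 0; the argument works for every t ≥ 1.
lemma15 : (n t k : ℕ) → 2 * t ≤ n → 4 ≤ 2 * t → 2 ≤ k →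
          ((+ A k n (replicate t 0)) / 1) ℚ.≤ (β k t ^ℚ n)
lemma15 n zero    k             _    ()  _
lemma15 n (suc s) zero          _    _   ()
lemma15 n (suc s) (suc zero)    _    _   (s≤s ())
lemma15 n (suc s) (suc (suc c)) 2t≤n _   _  = toℚᵘ-cancel-≤ (begin
  toℚᵘ ((+ A k n (zeros t)) / 1)  ≃⟨ toℚᵘ-/ (+ A k n (zeros t)) 1 ⟩
  mkℚᵘ (+ A k n (zeros t)) 0      ≤⟨ mkℚᵘ-≤ _ _ (K ^ n) (avoiding-bound (s≤s z≤n) 2t≤n) ⟩
  mkℚᵘ (+ (B ^ n)) (pred (K ^ n)) ≃⟨ toℚᵘ-^ℚ β≃B/K n ⟨
  toℚᵘ (β k t ^ℚ n)               ∎)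
  where
  open Bound (suc c) s
  open ℚᵘ.≤-Reasoning
  instance _ = m^n≢0 K n
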